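{- Let $T$ be a decomposition tree and $v$ an internal node of $T$ labeled $\otimes$, with left child $v_l$ and right child $v_r$. Let $D\subseteq V(\hat G(v))$, $D_l=D\cap V(\hat G(v_l))$ and $D_r=D\cap V(\hat G(v_r))$. Then $D\in\Psi(v)$ if and only if $D_l\in\Psi(v_l)$ and $D_r\in\Psi(v_r)$.
   Context: All graphs are finite, simple and undirected. For a graph $H$ and $S\subseteq V(H)$, $N_H[S]$ is the closed neighbourhood of $S$ in $H$ and $H[S]$ the induced subgraph; a graph with no vertices is regarded as having a (empty) perfect matching. A decomposition tree is a rooted tree $T$ in which every internal node has exactly two children, a left child $v_l$ and a right child $v_r$, and carries one of the labels $\otimes$ (true twin), $\odot$ (false twin), $\oplus$ (attachment). To each node $v$ are associated a graph $\hat G(v)$ and a twin set $\hat{TS}(v)\subseteq V(\hat G(v))$: for a leaf, $\hat G(v)$ is a single vertex $x$ (distinct leaves giving distinct vertices) and $\hat{TS}(v)=\{x\}$; for an internal node $v$, $V(\hat G(v))=V(\hat G(v_l))\cup V(\hat G(v_r))$ and: if $v$ is labeled $\otimes$, $E(\hat G(v))=E(\hat G(v_l))\cup E(\hat G(v_r))\cup\{xy: x\in \hat{TS}(v_l), y\in\hat{TS}(v_r)\}$ and $\hat{TS}(v)=\hat{TS}(v_l)\cup\hat{TS}(v_r)$; if labeled $\odot$, $E(\hat G(v))=E(\hat G(v_l))\cup E(\hat G(v_r))$ and $\hat{TS}(v)=\hat{TS}(v_l)\cup\hat{TS}(v_r)$; if labeled $\oplus$, the edge set is as for $\otimes$ and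 $\hat{TS}(v)=\hat{TS}(v_l)$. For a node $u$ and $0\le k\le|\hat{TS}(u)|$, $\hat\gamma_k(u)$ is the minimum of $|S|$ over all $S\subseteq V(\hat G(u))$ with $V(\hat G(u))\setminus \hat{TS}(u)\subseteq N_{\hat G(u)}[S]$ for which there is $X\subseteq S\cap\hat{TS}(u)$, $|X|=k$, such that $\hat G(u)[S\setminus X]$ has a perfect matching; $\hat D_k(u)$ is the family of such sets $S$ of size $\hat\gamma_k(u)$. Let $\widehat{\min}(u)=\min\{\hat\gamma_k(u):0\le k\le|\hat{TS}(u)|\}$ and $\Psi(u)=\{D: D\in\hat D_k(u)\text{ for some }k\text{ and }|D|=\widehat{\min}(u)\}$. -}

module Defs where

open import Data.Bool using (Bool; true; false; _∧_; T; not)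
open import Data.Nat using (ℕ; zero; suc; _+_; _≤_)
open import Data.Sum using (_⊎_; inj₁; inj₂)
open import Data.Unit using (⊤; tt)
open import Data.Product using (Σ; _×_; _,_)
open import Relation.Binary.PropositionalEquality using (_≡_; _≢_)
open import Function using (_∘_)

-- Node labels: ⊗ (true twin), ⊙ (false twin), ⊕ (attachment)
data Label : Set where
  ⊗ ⊙ ⊕ : Label

-- Every node of a decomposition
-- tree is the root of the subtree below it, and Ĝ(v), T̂S(v) only depend
-- on that subtree.
data DTree : Set where
  leaf : DTree
  node : Label → DTree → DTree → DTree

-- Vertices of Ĝ(v): the leaves of the subtree at v (distinct leaves are
-- distinct vertices).  V(Ĝ(v_l)) and V(Ĝ(v_r)) embed via inj₁ / inj₂.
Vert : DTree → Set
Vert leaf = ⊤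
Vert (node _ l r) = Vert l ⊎ Vert r

Subset : DTree → Set
Subset t = Vert t → Bool

card : (t : DTree) → Subset t → ℕ
card leaf S with S tt
... | true = 1
... | false = 0
card (node _ l r) S = card l (S ∘ inj₁) + card r (S ∘ inj₂)

TS : (t : DTree) → Subset t
TS leaf _ = true
TS (node ⊗ l r) (inj₁ x) = TS l x
TS (node ⊗ l r) (inj₂ y) = TS r y
TS (node ⊙ l r) (inj₁ x) = TS l x
TS (node ⊙ l r) (inj₂ y) = TS r y
TS (node ⊕ l r) (inj₁ x) = TS l x
TS (node ⊕ l r) (inj₂ y) = false

joins : Label → Bool
joins ⊗ = true
joins ⊙ = false
joins ⊕ = true

adj : (t : DTree) → Vert t → Vert t → Bool
adj leaf _ _ = false
adj (node a l r) (inj₁ x) (inj₁ y) = adj l x y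
adj (node a l r) (inj₂ x) (inj₂ y) = adj r x y
adj (node a l r) (inj₁ x) (inj₂ y) = joins a ∧ (TS l x ∧ TS r y)
adj (node a l r) (inj₂ x) (inj₁ y) = joins a ∧ (TS r x ∧ TS l y)

InClosedNbhd : (t : DTree) → Subset t → Vert t → Set
InClosedNbhd t S x = T (S x) ⊎ Σ (Vert t) (λ y → T (S y) × T (adj t y x))

_∖_ : {t : DTree} → Subset t → Subset t → Subset t
(S ∖ X) x = S x ∧ not (X x)

-- Ĝ(t)[S] has a perfect matching: a fixed-point-free involution m on S
-- with every pair {x, m x} an edge of Ĝ(t).  (Empty S: trivially.)
HasPerfectMatching : (t : DTree) → Subset t → Set
HasPerfectMatching t S =
  Σ (Vert t → Vert t) λ m →
    (x : Vert t) → T (S x) →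
      T (S (m x)) × (m x ≢ x) × T (adj t x (m x)) × (m (m x) ≡ x)

Admissible : (t : DTree) → ℕ → Subset t → Set
Admissible t k S =
  ((x : Vert t) → TS t x ≡ false → InClosedNbhd t S x) ×
  Σ (Subset t) λ X →
    ((x : Vert t) → T (X x) → T (S x) × T (TS t x)) ×
    (card t X ≡ k) ×
    HasPerfectMatching t (S ∖ X)

InD : (t : DTree) → ℕ → Subset t → Set
InD t k S = Admissible t k S × ((S' : Subset t) → Admissible t k S' → card t S ≤ card t S')

-- D ∈ Ψ(t): D ∈ D̂_k(t) for some 0 ≤ k ≤ |T̂S(t)| and
-- |D| = min_k γ̂_k(t), i.e. |D| ≤ γ̂_{k'}(t) for every k' (with γ̂_{k'} defined).
Ψ : (t : DTree) → Subset t → Set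
Ψ t D =
  Σ ℕ λ k → (k ≤ card t (TS t)) × InD t k D ×
    ((k' : ℕ) → k' ≤ card t (TS t) → (S : Subset t) → InD t k' S → card t D ≤ card t S)

{-# OPTIONS --safe #-}

-- Under ⊗ the graph Ĝ(v) is the disjoint union of Ĝ(v_l) and Ĝ(v_r) plus all
-- edges between the two twin sets; in particular a vertex outside the twin sets
-- has no neighbour on the other side. Hence S is admissible for v (for some k)
-- iff both halves are: non-twins are dominated within their own side, and a
-- matched pair crossing between the sides consists of two twins, which may be
-- moved into the unmatched part X instead. As |D| = |D_l| + |D_r|, D has
-- minimum size among such sets iff both halves do, and Ψ(u) consists exactly
-- of the minimum-size sets admissible for u for some k.

module Submission where

open import Defs
open import Data.Bool using (Bool; true; false; _∧_; _∨_; not; T)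
open import Data.Bool.Properties using (T-∧; T-∨)
open import Data.Empty using (⊥-elim)
open import Data.Maybe using (is-just)
open import Data.Nat using (ℕ; _≤_; _<_; _≤?_; z≤n)
open import Data.Nat.Induction using (<-wellFounded)
open import Data.Nat.Properties
  using (≤-refl; ≤-trans; <⇒≤; ≰⇒>; +-mono-≤; +-cancelˡ-≤; +-cancelʳ-≤)
open import Data.Product using (Σ; _×_; _,_; proj₁; proj₂)
open import Data.Product.Function.NonDependent.Propositional using (_×-⇔_)
open import Data.Sum using (_⊎_; inj₁; inj₂; [_,_]; fromInj₁; fromInj₂; isInj₁; isInj₂)
import Data.Sum as Sum
open import Data.Sum.Properties using (inj₁-injective; inj₂-injective)
open import Data.Unit using (tt)
open import Function using (_∘_; _⇔_; mk⇔; const)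
open import Function.Bundles using (module Equivalence)
open import Function.Construct.Symmetry using (⇔-sym)
open import Function.Related.Propositional using (module EquationalReasoning)
open import Induction.WellFounded using (Acc; acc)
open import Relation.Nullary using (yes; no)
open import Relation.Binary.PropositionalEquality using (_≡_; _≢_; _≗_; refl; sym; cong; subst)

IsMinimum : {A : Set} → (A → Set) → (A → ℕ) → A → Set
IsMinimum {A} P f a = P a × ((b : A) → P b → f a ≤ f b)

minima-lowerBound⇒lowerBound : {A : Set} (P : A → Set) (f : A → ℕ) (d : ℕ) →
  ((b : A) → IsMinimum P f b → d ≤ f b) → (a : A) → P a → d ≤ f a
minima-lowerBound⇒lowerBound {A} P f d bound a pa = go a pa (<-wellFounded (f a))
  where
  go : (a : A) → P a → Acc _<_ (f a) → d ≤ f a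
  go a pa (acc rs) with d ≤? f a
  ... | yes d≤fa = d≤fa
  ... | no d≰fa = ⊥-elim (d≰fa (bound a (pa , minimal)))
    where
    minimal : (c : A) → P c → f a ≤ f c
    minimal c pc with f a ≤? f c
    ... | yes fa≤fc = fa≤fc
    ... | no fa≰fc = ⊥-elim (d≰fa (≤-trans (go c pc (rs fc<fa)) (<⇒≤ fc<fa)))
      where
      fc<fa : f c < f a
      fc<fa = ≰⇒> fa≰fc

_⊆_ : {t : DTree} → Subset t → Subset t → Set
_⊆_ {t} A B = (x : Vert t) → T (A x) → T (B x)

⊆⇒card≤ : (t : DTree) {A B : Subset t} → A ⊆ B → card t A ≤ card t B
⊆⇒card≤ leaf {A} {B} A⊆B with A tt | B tt | A⊆B tt
... | true  | true  | _    = ≤-refl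
... | true  | false | A⇒B = ⊥-elim (A⇒B tt)
... | false | _     | _    = z≤n
⊆⇒card≤ (node _ l r) A⊆B = +-mono-≤ (⊆⇒card≤ l (A⊆B ∘ inj₁)) (⊆⇒card≤ r (A⊆B ∘ inj₂))

Feasible : (t : DTree) → Subset t → Set
Feasible t S = Σ ℕ λ k → Admissible t k S

admissible⇒≤card-TS : (t : DTree) {k : ℕ} {S : Subset t} → Admissible t k S → k ≤ card t (TS t)
admissible⇒≤card-TS t (_ , X , X⊆S∩TS , refl , _) = ⊆⇒card≤ t (λ x → proj₂ ∘ X⊆S∩TS x)

-- Ψ compares D only with the minimisers of each γ̂_k; by well-foundedness of ℕ
-- this extends to every admissible set, without constructing a minimiser.
Ψ⇔IsMinimum : (t : DTree) (D : Subset t) → Ψ t D ⇔ IsMinimum (Feasible t) (card t) D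
Ψ⇔IsMinimum t D = mk⇔ to from
  where
  to : Ψ t D → IsMinimum (Feasible t) (card t) D
  to (k , _ , (adm , _) , ≤minima) = (k , adm) , λ S (k′ , admS) →
    minima-lowerBound⇒lowerBound (Admissible t k′) (card t) (card t D)
      (≤minima k′ (admissible⇒≤card-TS t admS)) S admS
  from : IsMinimum (Feasible t) (card t) D → Ψ t D
  from ((k , adm) , min) =
    k , admissible⇒≤card-TS t adm , (adm , λ S admS → min S (k , admS)) ,
    λ k′ _ S (admS , _) → min S (k′ , admS)

_∪_ _∩_ : {t : DTree} → Subset t → Subset t → Subset t
(A ∪ B) x = A x ∨ B x
(A ∩ B) x = A x ∧ B x

∖-∪-∖-∩ : {t : DTree} (S X C : Subset t) → S ∖ (X ∪ ((S ∖ X) ∩ C)) ≗ (S ∖ X) ∖ C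
∖-∪-∖-∩ S X C x with S x | X x
... | true  | true  = refl
... | true  | false = refl
... | false | _     = refl

IsPerfectMatching : (t : DTree) → Subset t → (Vert t → Vert t) → Set
IsPerfectMatching t M m =
  (x : Vert t) → T (M x) → T (M (m x)) × (m x ≢ x) × T (adj t x (m x)) × (m (m x) ≡ x)

hasPerfectMatching-resp-≗ : {t : DTree} {A B : Subset t} →
  A ≗ B → HasPerfectMatching t A → HasPerfectMatching t B
hasPerfectMatching-resp-≗ A≗B (m , m-perfect) = m , λ x Bx →
  let Amx , mx≢x , edge , mmx≡x = m-perfect x (subst T (sym (A≗B x)) Bx)
  in subst T (A≗B (m x)) Amx , mx≢x , edge , mmx≡x

hasPerfectMatching-join : {a : Label} {l r : DTree} {M : Subset (node a l r)} →
  HasPerfectMatching l (M ∘ inj₁) → HasPerfectMatching r (M ∘ inj₂) → HasPerfectMatching (node a l r) M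
hasPerfectMatching-join (mₗ , mₗ-perfect) (mᵣ , mᵣ-perfect) = Sum.map mₗ mᵣ , perfect
  where
  perfect : IsPerfectMatching _ _ (Sum.map mₗ mᵣ)
  perfect (inj₁ x) Mx = let My , y≢x , edge , mmx≡x = mₗ-perfect x Mx
                        in My , y≢x ∘ inj₁-injective , edge , cong inj₁ mmx≡x
  perfect (inj₂ x) Mx = let My , y≢x , edge , mmx≡x = mᵣ-perfect x Mx
                        in My , y≢x ∘ inj₂-injective , edge , cong inj₂ mmx≡x

crossesˡ : {A B : Set} → (A ⊎ B → A ⊎ B) → A → Bool
crossesˡ m = is-just ∘ isInj₂ ∘ m ∘ inj₁

crossesʳ : {A B : Set} → (A ⊎ B → A ⊎ B) → B → Bool
crossesʳ m = is-just ∘ isInj₁ ∘ m ∘ inj₂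

hasPerfectMatching-restrictˡ : {a : Label} {l r : DTree} {M : Subset (node a l r)}
  {m : Vert (node a l r) → Vert (node a l r)} →
  IsPerfectMatching (node a l r) M m → HasPerfectMatching l ((M ∘ inj₁) ∖ crossesˡ m)
hasPerfectMatching-restrictˡ {l = l} {M = M} {m} m-perfect = mₗ , perfect
  where
  mₗ : Vert l → Vert l
  mₗ x = fromInj₁ (const x) (m (inj₁ x))
  perfect : IsPerfectMatching l ((M ∘ inj₁) ∖ crossesˡ m) mₗ
  perfect x Mx∖C with Equivalence.to (T-∧ {M (inj₁ x)}) Mx∖C
  ... | Mx , notCrossing with m (inj₁ x) | m-perfect (inj₁ x) Mx
  ... | inj₁ y | My , y≢x , edge , mmx≡x =
    Equivalence.from (T-∧ {M (inj₁ y)}) (My , subst (T ∘ not ∘ is-just ∘ isInj₂) (sym mmx≡x) tt) ,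
    y≢x ∘ cong inj₁ , edge , cong (fromInj₁ (const y)) mmx≡x
  ... | inj₂ _ | _ = ⊥-elim notCrossing

hasPerfectMatching-restrictʳ : {a : Label} {l r : DTree} {M : Subset (node a l r)}
  {m : Vert (node a l r) → Vert (node a l r)} →
  IsPerfectMatching (node a l r) M m → HasPerfectMatching r ((M ∘ inj₂) ∖ crossesʳ m)
hasPerfectMatching-restrictʳ {r = r} {M = M} {m} m-perfect = mᵣ , perfect
  where
  mᵣ : Vert r → Vert r
  mᵣ x = fromInj₂ (const x) (m (inj₂ x))
  perfect : IsPerfectMatching r ((M ∘ inj₂) ∖ crossesʳ m) mᵣ
  perfect x Mx∖C with Equivalence.to (T-∧ {M (inj₂ x)}) Mx∖C
  ... | Mx , notCrossing with m (inj₂ x) | m-perfect (inj₂ x) Mx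
  ... | inj₂ y | My , y≢x , edge , mmx≡x =
    Equivalence.from (T-∧ {M (inj₂ y)}) (My , subst (T ∘ not ∘ is-just ∘ isInj₁) (sym mmx≡x) tt) ,
    y≢x ∘ cong inj₂ , edge , cong (fromInj₂ (const y)) mmx≡x
  ... | inj₁ _ | _ = ⊥-elim notCrossing

⊗-crossesˡ⇒TS : {l r : DTree} {M : Subset (node ⊗ l r)} {m : Vert (node ⊗ l r) → Vert (node ⊗ l r)} →
  IsPerfectMatching (node ⊗ l r) M m → (x : Vert l) → T (M (inj₁ x)) → T (crossesˡ m x) → T (TS l x)
⊗-crossesˡ⇒TS {l} {r} {m = m} m-perfect x Mx crossing with m (inj₁ x) | m-perfect (inj₁ x) Mx
... | inj₂ y | _ , _ , edge , _ = proj₁ (Equivalence.to (T-∧ {TS l x} {TS r y}) edge)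
... | inj₁ _ | _ = ⊥-elim crossing

⊗-crossesʳ⇒TS : {l r : DTree} {M : Subset (node ⊗ l r)} {m : Vert (node ⊗ l r) → Vert (node ⊗ l r)} →
  IsPerfectMatching (node ⊗ l r) M m → (x : Vert r) → T (M (inj₂ x)) → T (crossesʳ m x) → T (TS r x)
⊗-crossesʳ⇒TS {l} {r} {m = m} m-perfect x Mx crossing with m (inj₂ x) | m-perfect (inj₂ x) Mx
... | inj₁ y | _ , _ , edge , _ = proj₁ (Equivalence.to (T-∧ {TS r x} {TS l y}) edge)
... | inj₂ _ | _ = ⊥-elim crossing

⊗-nbhd-restrictˡ : {l r : DTree} {S : Subset (node ⊗ l r)} {x : Vert l} → TS l x ≡ false →
  InClosedNbhd (node ⊗ l r) S (inj₁ x) → InClosedNbhd l (S ∘ inj₁) x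
⊗-nbhd-restrictˡ _ (inj₁ Sx) = inj₁ Sx
⊗-nbhd-restrictˡ _ (inj₂ (inj₁ y , Sy , edge)) = inj₂ (y , Sy , edge)
⊗-nbhd-restrictˡ {l} {r} {x = x} x∉TS (inj₂ (inj₂ y , _ , edge)) =
  ⊥-elim (subst T x∉TS (proj₂ (Equivalence.to (T-∧ {TS r y} {TS l x}) edge)))

⊗-nbhd-restrictʳ : {l r : DTree} {S : Subset (node ⊗ l r)} {x : Vert r} → TS r x ≡ false →
  InClosedNbhd (node ⊗ l r) S (inj₂ x) → InClosedNbhd r (S ∘ inj₂) x
⊗-nbhd-restrictʳ _ (inj₁ Sx) = inj₁ Sx
⊗-nbhd-restrictʳ _ (inj₂ (inj₂ y , Sy , edge)) = inj₂ (y , Sy , edge)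
⊗-nbhd-restrictʳ {l} {r} {x = x} x∉TS (inj₂ (inj₁ y , _ , edge)) =
  ⊥-elim (subst T x∉TS (proj₂ (Equivalence.to (T-∧ {TS l y} {TS r x}) edge)))

-- Crossing matched pairs join two twins, so they are moved into X.
⊗-admissible-restrictˡ : {l r : DTree} {k : ℕ} {S : Subset (node ⊗ l r)} →
  Admissible (node ⊗ l r) k S → Feasible l (S ∘ inj₁)
⊗-admissible-restrictˡ {l} {S = S} (dominated , X , X⊆S∩TS , _ , m , m-perfect) =
  card l Xₗ , (λ x x∉TS → ⊗-nbhd-restrictˡ x∉TS (dominated (inj₁ x) x∉TS)) , Xₗ , Xₗ⊆S∩TS , refl ,
  hasPerfectMatching-resp-≗ (sym ∘ ∖-∪-∖-∩ (S ∘ inj₁) (X ∘ inj₁) (crossesˡ m))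
    (hasPerfectMatching-restrictˡ m-perfect)
  where
  Xₗ : Subset l
  Xₗ = (X ∘ inj₁) ∪ (((S ∘ inj₁) ∖ (X ∘ inj₁)) ∩ crossesˡ m)
  Xₗ⊆S∩TS : (x : Vert l) → T (Xₗ x) → T (S (inj₁ x)) × T (TS l x)
  Xₗ⊆S∩TS x x∈Xₗ with Equivalence.to (T-∨ {X (inj₁ x)}) x∈Xₗ
  ... | inj₁ x∈X = X⊆S∩TS (inj₁ x) x∈X
  ... | inj₂ x∈M∩C with Equivalence.to (T-∧ {S (inj₁ x) ∧ not (X (inj₁ x))}) x∈M∩C
  ... | x∈M , crossing =
    proj₁ (Equivalence.to (T-∧ {S (inj₁ x)}) x∈M) , ⊗-crossesˡ⇒TS m-perfect x x∈M crossing

⊗-admissible-restrictʳ : {l r : DTree} {k : ℕ} {S : Subset (node ⊗ l r)} →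
  Admissible (node ⊗ l r) k S → Feasible r (S ∘ inj₂)
⊗-admissible-restrictʳ {r = r} {S = S} (dominated , X , X⊆S∩TS , _ , m , m-perfect) =
  card r Xᵣ , (λ x x∉TS → ⊗-nbhd-restrictʳ x∉TS (dominated (inj₂ x) x∉TS)) , Xᵣ , Xᵣ⊆S∩TS , refl ,
  hasPerfectMatching-resp-≗ (sym ∘ ∖-∪-∖-∩ (S ∘ inj₂) (X ∘ inj₂) (crossesʳ m))
    (hasPerfectMatching-restrictʳ m-perfect)
  where
  Xᵣ : Subset r
  Xᵣ = (X ∘ inj₂) ∪ (((S ∘ inj₂) ∖ (X ∘ inj₂)) ∩ crossesʳ m)
  Xᵣ⊆S∩TS : (x : Vert r) → T (Xᵣ x) → T (S (inj₂ x)) × T (TS r x)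
  Xᵣ⊆S∩TS x x∈Xᵣ with Equivalence.to (T-∨ {X (inj₂ x)}) x∈Xᵣ
  ... | inj₁ x∈X = X⊆S∩TS (inj₂ x) x∈X
  ... | inj₂ x∈M∩C with Equivalence.to (T-∧ {S (inj₂ x) ∧ not (X (inj₂ x))}) x∈M∩C
  ... | x∈M , crossing =
    proj₁ (Equivalence.to (T-∧ {S (inj₂ x)}) x∈M) , ⊗-crossesʳ⇒TS m-perfect x x∈M crossing

inClosedNbhd-inj₁ : {a : Label} {l r : DTree} {S : Subset (node a l r)} {x : Vert l} →
  InClosedNbhd l (S ∘ inj₁) x → InClosedNbhd (node a l r) S (inj₁ x)
inClosedNbhd-inj₁ (inj₁ Sx) = inj₁ Sx
inClosedNbhd-inj₁ (inj₂ (y , Sy , edge)) = inj₂ (inj₁ y , Sy , edge)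

inClosedNbhd-inj₂ : {a : Label} {l r : DTree} {S : Subset (node a l r)} {x : Vert r} →
  InClosedNbhd r (S ∘ inj₂) x → InClosedNbhd (node a l r) S (inj₂ x)
inClosedNbhd-inj₂ (inj₁ Sx) = inj₁ Sx
inClosedNbhd-inj₂ (inj₂ (y , Sy , edge)) = inj₂ (inj₂ y , Sy , edge)

⊗-feasible-join : {l r : DTree} {S : Subset (node ⊗ l r)} →
  Feasible l (S ∘ inj₁) → Feasible r (S ∘ inj₂) → Feasible (node ⊗ l r) S
⊗-feasible-join {l} {r} {S}
  (_ , dominatedₗ , Xₗ , Xₗ⊆S∩TS , _ , perfectₗ) (_ , dominatedᵣ , Xᵣ , Xᵣ⊆S∩TS , _ , perfectᵣ) =
  card G X , dominated , X , X⊆S∩TS , refl , hasPerfectMatching-join perfectₗ perfectᵣ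
  where
  G : DTree
  G = node ⊗ l r
  X : Subset G
  X = [ Xₗ , Xᵣ ]
  dominated : (x : Vert G) → TS G x ≡ false → InClosedNbhd G S x
  dominated (inj₁ x) x∉TS = inClosedNbhd-inj₁ (dominatedₗ x x∉TS)
  dominated (inj₂ x) x∉TS = inClosedNbhd-inj₂ (dominatedᵣ x x∉TS)
  X⊆S∩TS : (x : Vert G) → T (X x) → T (S x) × T (TS G x)
  X⊆S∩TS (inj₁ x) = Xₗ⊆S∩TS x
  X⊆S∩TS (inj₂ x) = Xᵣ⊆S∩TS x

⊗-feasible⇔ : {l r : DTree} (S : Subset (node ⊗ l r)) →
  Feasible (node ⊗ l r) S ⇔ (Feasible l (S ∘ inj₁) × Feasible r (S ∘ inj₂))
⊗-feasible⇔ S = mk⇔ (λ (_ , adm) → ⊗-admissible-restrictˡ adm , ⊗-admissible-restrictʳ adm)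
               (λ (admₗ , admᵣ) → ⊗-feasible-join admₗ admᵣ)

isMinimum-node⇔ : {a : Label} {l r : DTree} →
  ((S : Subset (node a l r)) → Feasible (node a l r) S ⇔ (Feasible l (S ∘ inj₁) × Feasible r (S ∘ inj₂))) →
  (D : Subset (node a l r)) →
  IsMinimum (Feasible (node a l r)) (card (node a l r)) D ⇔
  (IsMinimum (Feasible l) (card l) (D ∘ inj₁) × IsMinimum (Feasible r) (card r) (D ∘ inj₂))
isMinimum-node⇔ {a} {l} {r} feasible⇔ D = mk⇔ to from
  where
  G : DTree
  G = node a l r
  to : IsMinimum (Feasible G) (card G) D →
       IsMinimum (Feasible l) (card l) (D ∘ inj₁) × IsMinimum (Feasible r) (card r) (D ∘ inj₂)
  to (admD , minD) = (admₗ , minₗ) , (admᵣ , minᵣ)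
    where
    admₗ : Feasible l (D ∘ inj₁)
    admₗ = proj₁ (Equivalence.to (feasible⇔ D) admD)
    admᵣ : Feasible r (D ∘ inj₂)
    admᵣ = proj₂ (Equivalence.to (feasible⇔ D) admD)
    minₗ : (S : Subset l) → Feasible l S → card l (D ∘ inj₁) ≤ card l S
    minₗ S admS = +-cancelʳ-≤ (card r (D ∘ inj₂)) _ _
      (minD [ S , D ∘ inj₂ ] (Equivalence.from (feasible⇔ _) (admS , admᵣ)))
    minᵣ : (S : Subset r) → Feasible r S → card r (D ∘ inj₂) ≤ card r S
    minᵣ S admS = +-cancelˡ-≤ (card l (D ∘ inj₁)) _ _
      (minD [ D ∘ inj₁ , S ] (Equivalence.from (feasible⇔ _) (admₗ , admS)))
  from : IsMinimum (Feasible l) (card l) (D ∘ inj₁) × IsMinimum (Feasible r) (card r) (D ∘ inj₂) →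
         IsMinimum (Feasible G) (card G) D
  from ((admₗ , minₗ) , (admᵣ , minᵣ)) = Equivalence.from (feasible⇔ D) (admₗ , admᵣ) , λ S admS →
    let admSₗ , admSᵣ = Equivalence.to (feasible⇔ S) admS
    in +-mono-≤ (minₗ (S ∘ inj₁) admSₗ) (minᵣ (S ∘ inj₂) admSᵣ)

lemma7 : (l r : DTree) (D : Subset (node ⊗ l r)) →
    Ψ (node ⊗ l r) D ⇔ (Ψ l (D ∘ inj₁) × Ψ r (D ∘ inj₂))
lemma7 l r D = begin
  Ψ (node ⊗ l r) D
    ∼⟨ Ψ⇔IsMinimum (node ⊗ l r) D ⟩
  IsMinimum (Feasible (node ⊗ l r)) (card (node ⊗ l r)) D
    ∼⟨ isMinimum-node⇔ ⊗-feasible⇔ D ⟩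
  (IsMinimum (Feasible l) (card l) (D ∘ inj₁) × IsMinimum (Feasible r) (card r) (D ∘ inj₂))
    ∼⟨ ⇔-sym (Ψ⇔IsMinimum l (D ∘ inj₁)) ×-⇔ ⇔-sym (Ψ⇔IsMinimum r (D ∘ inj₂)) ⟩
  (Ψ l (D ∘ inj₁) × Ψ r (D ∘ inj₂)) ∎
  where open EquationalReasoning
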